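{- Let $k$ and $l$ be distinct, positive, relatively prime, square-free integers, and suppose $2$ divides $k$ or $l$. Let $E$ be the elliptic curve $y^2=x^{3}-3k^{2}l^{2}x+k^{2}l^{2}(k^{2}+l^{2})$. If $(x,y)$ is an integral point of $E(\mathbb{Q})$, then $$v_{2}\big(x(2(x,y))\big)=\begin{cases}0 & \text{if } v_2(x)\geq 2,\\ 2 & \text{if } v_2(x)=1,\\ -2 & \text{if } v_2(x)=0.\end{cases}$$ Hence $8(x,y)$ is not an integral point of $E(\mathbb{Q})$.
   Context: $E(\mathbb{Q})=\{(x,y)\in\mathbb{Q}^2: y^2=x^{3}-3k^{2}l^{2}x+k^{2}l^{2}(k^{2}+l^{2})\}\cup\{\infty\}$ with the standard elliptic curve group law and identity the point at infinity $\infty$; $n(x,y)$ denotes the $n$-fold sum of $(x,y)$ in this group. An integral point is a point $(x,y)\neq\infty$ with $x,y\in\mathbb{Z}$. For a point $P=(a,b)\neq\infty$, $x(P)=a$. For a prime $p$ and nonzero rational $x$, $v_p(x)$ is the exponent of $p$ in the prime factorization of $x$. -}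

module Defs where

open import Data.Nat as ℕ using (ℕ; zero; suc)
open import Data.Nat.Divisibility using (_∣_; _∣?_)
open import Data.Nat.DivMod as DM using ()
open import Data.Integer as ℤ using (ℤ; +_)
open import Data.Rational as ℚ using (ℚ; 0ℚ; ½; _*_; _+_; _-_; _÷_; ≢-nonZero)

fromℤ : ℤ → ℚ
fromℤ a = a ℚ./ 1
open import Data.Rational.Properties using (_≟_)
open import Relation.Nullary using (yes; no)

data Point : Set where
  ∞   : Point
  aff : ℚ → ℚ → Point

coefA : ℕ → ℕ → ℤ
coefA k l = ℤ.- (+ 3 ℤ.* (+ k ℤ.* + k) ℤ.* (+ l ℤ.* + l))

coefB : ℕ → ℕ → ℤ
coefB k l = (+ k ℤ.* + k) ℤ.* (+ l ℤ.* + l) ℤ.* ((+ k ℤ.* + k) ℤ.+ (+ l ℤ.* + l))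

double : ℤ → Point → Point
double A ∞ = ∞
double A (aff x y) with y ≟ 0ℚ
... | yes _ = ∞
... | no y≢0 = aff x' y'
  where
    instance _ = ≢-nonZero y≢0
    lam : ℚ
    lam = ((fromℤ (+ 3) * x * x + fromℤ A) * ½) ÷ y
    x' : ℚ
    x' = lam * lam - fromℤ (+ 2) * x
    y' : ℚ
    y' = lam * (x - x') - y

mul2 mul4 mul8 : ℤ → Point → Point
mul2 A P = double A P
mul4 A P = double A (double A P)
mul8 A P = double A (double A (double A P))

IsIntegral : Point → Set
IsIntegral ∞ = Data.Empty.⊥ where import Data.Empty
IsIntegral (aff x y) = Σ ℤ (λ a → Σ ℤ (λ b → (x ≡ fromℤ a) × (y ≡ fromℤ b)))
  where
    open import Data.Product using (Σ; _×_)
    open import Relation.Binary.PropositionalEquality using (_≡_)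

-- p-adic valuation of a positive natural number (exponent of p),
-- computed with fuel n (enough since each step halves at least).
vℕ-aux : ℕ → (p : ℕ) → .{{_ : ℕ.NonZero p}} → ℕ → ℕ
vℕ-aux zero p n = 0
vℕ-aux (suc f) p zero = 0
vℕ-aux (suc f) p (suc m) with p ∣? suc m
... | yes _ = suc (vℕ-aux f p (suc m DM./ p))
... | no _  = 0

vℕ : (p : ℕ) → .{{_ : ℕ.NonZero p}} → ℕ → ℕ
vℕ p n = vℕ-aux n p n

-- p-adic valuation of a (nonzero) rational in lowest terms:
-- v_p(num) - v_p(den).  (Only meaningful for nonzero rationals.)
vℚ : (p : ℕ) → .{{_ : ℕ.NonZero p}} → ℚ → ℤ
vℚ p q = + vℕ p (ℤ.∣ ℚ.numerator q ∣) ℤ.- + vℕ p (ℚ.denominatorℕ q)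

SquareFree : ℕ → Set
SquareFree n = ∀ d → d ℕ.* d ∣ n → d ≡ 1
  where open import Relation.Binary.PropositionalEquality using (_≡_)

{-# OPTIONS --safe #-}
-- For an integral point P = (x, y) the x-coordinate X of 2P satisfies X · 4f(x) = N(x), where
-- f(x) = x³ + A x + B and N(x) = (3x² + A)² − 8x f(x).  When 2 divides exactly one of the
-- square-free numbers k, l, the coefficients are A = −12m², B = 4m²c with m, c odd.  Then
-- v₂(4f(x)) = 2, 4, 4 and v₂(N(x)) = 0, 6, 4 for x odd, x ≡ 2 (mod 4) and 4 ∣ x, and comparing
-- 2-adic valuations in X = ↥X/↧X (coprime) gives v₂(X) = −2, 2, 0.
-- Doubling never makes a non-integral x-coordinate integral: if x = a/c in lowest terms and
-- x(2P) = z ∈ ℤ, clearing denominators in z · 4f(x) = N(x) gives c ∣ a⁴, so c = 1.  Hence 2P is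
-- non-integral for odd x; for 4 ∣ x, 2P is non-integral or has odd integral x, so 4P is
-- non-integral; for x ≡ 2 (mod 4), 2P is non-integral or has x divisible by 4, so 8P is.
module Submission where

open import Defs
open import Data.Nat as ℕ using (ℕ; _<_; zero; suc; s≤s; z≤n)
open import Data.Nat.Divisibility as ND using (_∣_; divides; _∣?_)
open import Data.Nat.Coprimality as NC using (Coprime)
open import Data.Nat.Primality using (Prime; prime?; euclidsLemma)
open import Data.Integer as ℤ using (ℤ; +_; -[1+_])
open import Data.Integer.Divisibility as ℤD using ()
open import Data.Integer.Divisibility.Signed as ℤDˢ using (∣ᵤ⇒∣; ∣⇒∣ᵤ)
import Data.Integer.DivMod as ℤDM
open import Data.Rational as ℚ using (ℚ; 0ℚ; 1ℚ; ½; ↥_; ↧_; ↧ₙ_; mkℚ)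
open import Data.Product using (Σ; _×_; _,_; proj₁; proj₂)
open import Data.Sum using (_⊎_; inj₁; inj₂; [_,_]′)
open import Data.Empty using (⊥; ⊥-elim)
open import Data.Unit using (⊤; tt)
open import Algebra.Bundles using (CommutativeMonoid)
open import Function using (id)
open import Relation.Nullary using (¬_; yes; no; contradiction)
open import Relation.Nullary.Decidable using (from-yes)
open import Relation.Binary.PropositionalEquality
import Data.Nat.Properties as ℕP
import Data.Nat.DivMod as ℕDM
import Algebra.Properties.CommutativeSemigroup ℕP.*-commutativeSemigroup as ℕ*
import Data.Integer.Properties as ℤP
import Data.Rational.Properties as ℚP
import Algebra.Properties.CommutativeSemigroup (CommutativeMonoid.commutativeSemigroup ℚP.*-1-commutativeMonoid) as ℚ*
import Data.Rational.Unnormalised as ℚᵘ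
import Data.Rational.Unnormalised.Properties as ℚᵘP
open import Data.Integer.GCD using (gcd; gcd-zeroʳ)
open import Data.Nat.Tactic.RingSolver as ℕSolver using ()
open import Data.Integer.Tactic.RingSolver as ℤSolver using ()
open import Data.Rational.Solver using (module +-*-Solver)
import Data.Integer.Solver as ℤSolverˢ
open import Relation.Binary.Reasoning.Setoid ℚᵘP.≃-setoid as ≃-Reasoning using ()
open import Algebra.Properties.Group ℚP.+-0-group using (x∙y⁻¹≈ε⇒x≈y; x≈y⇒x∙y⁻¹≈ε)

toℚᵘ-fromℤ : ∀ a → ℚ.toℚᵘ (fromℤ a) ℚᵘ.≃ ℚᵘ.mkℚᵘ a 0
toℚᵘ-fromℤ a = ℚP.toℚᵘ-fromℚᵘ (ℚᵘ.mkℚᵘ a 0)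

fromℤ-+ : ∀ a b → fromℤ (a ℤ.+ b) ≡ fromℤ a ℚ.+ fromℤ b
fromℤ-+ a b = ℚP.toℚᵘ-injective (begin
  ℚ.toℚᵘ (fromℤ (a ℤ.+ b))               ≈⟨ toℚᵘ-fromℤ (a ℤ.+ b) ⟩
  ℚᵘ.mkℚᵘ (a ℤ.+ b) 0                    ≈⟨ ℚᵘ.*≡* (cong (ℤ._* + 1) (sym (cong₂ ℤ._+_ (ℤP.*-identityʳ a) (ℤP.*-identityʳ b)))) ⟩
  ℚᵘ.mkℚᵘ a 0 ℚᵘ.+ ℚᵘ.mkℚᵘ b 0           ≈⟨ ℚᵘP.+-cong (toℚᵘ-fromℤ a) (toℚᵘ-fromℤ b) ⟨
  ℚ.toℚᵘ (fromℤ a) ℚᵘ.+ ℚ.toℚᵘ (fromℤ b) ≈⟨ ℚP.toℚᵘ-homo-+ (fromℤ a) (fromℤ b) ⟨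
  ℚ.toℚᵘ (fromℤ a ℚ.+ fromℤ b)           ∎)
  where open ≃-Reasoning

fromℤ-* : ∀ a b → fromℤ (a ℤ.* b) ≡ fromℤ a ℚ.* fromℤ b
fromℤ-* a b = ℚP.toℚᵘ-injective (begin
  ℚ.toℚᵘ (fromℤ (a ℤ.* b))               ≈⟨ toℚᵘ-fromℤ (a ℤ.* b) ⟩
  ℚᵘ.mkℚᵘ (a ℤ.* b) 0                    ≈⟨ ℚᵘ.*≡* refl ⟩
  ℚᵘ.mkℚᵘ a 0 ℚᵘ.* ℚᵘ.mkℚᵘ b 0           ≈⟨ ℚᵘP.*-cong (toℚᵘ-fromℤ a) (toℚᵘ-fromℤ b) ⟨
  ℚ.toℚᵘ (fromℤ a) ℚᵘ.* ℚ.toℚᵘ (fromℤ b) ≈⟨ ℚP.toℚᵘ-homo-* (fromℤ a) (fromℤ b) ⟨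
  ℚ.toℚᵘ (fromℤ a ℚ.* fromℤ b)           ∎)
  where open ≃-Reasoning

fromℤ-neg : ∀ a → fromℤ (ℤ.- a) ≡ ℚ.- fromℤ a
fromℤ-neg a = ℚP.toℚᵘ-injective (begin
  ℚ.toℚᵘ (fromℤ (ℤ.- a))  ≈⟨ toℚᵘ-fromℤ (ℤ.- a) ⟩
  ℚᵘ.mkℚᵘ (ℤ.- a) 0       ≈⟨ ℚᵘ.*≡* refl ⟩
  ℚᵘ.- ℚᵘ.mkℚᵘ a 0        ≈⟨ ℚᵘP.-‿cong (toℚᵘ-fromℤ a) ⟨
  ℚᵘ.- ℚ.toℚᵘ (fromℤ a)   ≈⟨ ℚP.toℚᵘ-homo‿- (fromℤ a) ⟨
  ℚ.toℚᵘ (ℚ.- fromℤ a)    ∎)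
  where open ≃-Reasoning

fromℤ-injective : ∀ {a b} → fromℤ a ≡ fromℤ b → a ≡ b
fromℤ-injective {a} {b} e
  with ℚᵘP.≃-trans (ℚᵘP.≃-sym (toℚᵘ-fromℤ a)) (ℚᵘP.≃-trans (ℚP.toℚᵘ-cong e) (toℚᵘ-fromℤ b))
... | ℚᵘ.*≡* a*1≡b*1 = trans (sym (ℤP.*-identityʳ a)) (trans a*1≡b*1 (ℤP.*-identityʳ b))

↧ₙ-fromℤ : ∀ a → ↧ₙ fromℤ a ≡ 1
↧ₙ-fromℤ a = ℤP.+-injective (begin
  ↧ fromℤ a                       ≡⟨ ℤP.*-identityʳ (↧ fromℤ a) ⟨
  ↧ fromℤ a ℤ.* + 1               ≡⟨ cong (↧ fromℤ a ℤ.*_) (gcd-zeroʳ a) ⟨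
  ↧ fromℤ a ℤ.* gcd a (+ 1)     ≡⟨ ℚP.↧-/ a 1 ⟩
  + 1                              ∎)
  where open ≡-Reasoning

↧ₙ≡1⇒≡fromℤ : ∀ x → ↧ₙ x ≡ 1 → x ≡ fromℤ (↥ x)
↧ₙ≡1⇒≡fromℤ x@(mkℚ _ zero _) _ = sym (ℚP.↥p/↧p≡p x)

*-fromℤ-↧ : ∀ x → x ℚ.* fromℤ (↧ x) ≡ fromℤ (↥ x)
*-fromℤ-↧ x@(mkℚ a d-1 _) = ℚP.toℚᵘ-injective (begin
  ℚ.toℚᵘ (x ℚ.* fromℤ (↧ x))           ≈⟨ ℚP.toℚᵘ-homo-* x (fromℤ (↧ x)) ⟩
  ℚ.toℚᵘ x ℚᵘ.* ℚ.toℚᵘ (fromℤ (↧ x))   ≈⟨ ℚᵘP.*-cong (ℚᵘP.≃-refl {ℚ.toℚᵘ x}) (toℚᵘ-fromℤ (↧ x)) ⟩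
  ℚ.toℚᵘ x ℚᵘ.* ℚᵘ.mkℚᵘ (↧ x) 0        ≈⟨ ℚᵘ.*≡* (trans (ℤP.*-identityʳ _) (cong (λ n → a ℤ.* + n) (sym (ℕP.*-identityʳ (suc d-1))))) ⟩
  ℚᵘ.mkℚᵘ a 0                          ≈⟨ toℚᵘ-fromℤ a ⟨
  ℚ.toℚᵘ (fromℤ a)                     ∎)
  where open ≃-Reasoning

cross-multiply : ∀ X D N → X ℚ.* fromℤ D ≡ fromℤ N → ↥ X ℤ.* D ≡ ↧ X ℤ.* N
cross-multiply X D N XD≡N = fromℤ-injective (begin
  fromℤ (↥ X ℤ.* D)                ≡⟨ fromℤ-* (↥ X) D ⟩
  fromℤ (↥ X) ℚ.* fromℤ D          ≡⟨ cong (ℚ._* fromℤ D) (*-fromℤ-↧ X) ⟨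
  X ℚ.* fromℤ (↧ X) ℚ.* fromℤ D    ≡⟨ ℚ*.xy∙z≈y∙xz X (fromℤ (↧ X)) (fromℤ D) ⟩
  fromℤ (↧ X) ℚ.* (X ℚ.* fromℤ D)  ≡⟨ cong (fromℤ (↧ X) ℚ.*_) XD≡N ⟩
  fromℤ (↧ X) ℚ.* fromℤ N          ≡⟨ fromℤ-* (↧ X) N ⟨
  fromℤ (↧ X ℤ.* N)                ∎)
  where open ≡-Reasoning

-- One expression is evaluated in ℤ, in ℚ and as a ring-solver polynomial, so each polynomial
-- of the argument is written once and transported between ℤ and ℚ by fromℤ-⟦⟧.
infix  8 ‵_ #_
infixl 7 _⊗_
infixl 6 _⊕_ _⊖_

data Expr (V : Set) : Set where
  ‵_          : V → Expr V
  #_          : ℤ → Expr V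
  _⊕_ _⊖_ _⊗_ : Expr V → Expr V → Expr V

fold : ∀ {P : Set} → (ℤ → P) → (P → P → P) → (P → P → P) → (P → P → P) → Expr P → P
fold c _+_ _-_ _*_ (‵ p)   = p
fold c _+_ _-_ _*_ (# i)   = c i
fold c _+_ _-_ _*_ (e ⊕ f) = fold c _+_ _-_ _*_ e + fold c _+_ _-_ _*_ f
fold c _+_ _-_ _*_ (e ⊖ f) = fold c _+_ _-_ _*_ e - fold c _+_ _-_ _*_ f
fold c _+_ _-_ _*_ (e ⊗ f) = fold c _+_ _-_ _*_ e * fold c _+_ _-_ _*_ f

mapᴱ : ∀ {V W : Set} → (V → W) → Expr V → Expr W
mapᴱ f (‵ v)   = ‵ f v
mapᴱ f (# i)   = # i
mapᴱ f (e ⊕ g) = mapᴱ f e ⊕ mapᴱ f g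
mapᴱ f (e ⊖ g) = mapᴱ f e ⊖ mapᴱ f g
mapᴱ f (e ⊗ g) = mapᴱ f e ⊗ mapᴱ f g

⟦_⟧ℤ : Expr ℤ → ℤ
⟦_⟧ℤ = fold id ℤ._+_ ℤ._-_ ℤ._*_

⟦_⟧ℚ : Expr ℚ → ℚ
⟦_⟧ℚ = fold fromℤ ℚ._+_ ℚ._-_ ℚ._*_

module ℚS = +-*-Solver
module ℤS = ℤSolverˢ.+-*-Solver

polyℤ : ∀ {n} → Expr (ℤS.Polynomial n) → ℤS.Polynomial n
polyℤ = fold ℤS.con ℤS._:+_ ℤS._:-_ ℤS._:*_

polyℚ : ∀ {n} → Expr (ℚS.Polynomial n) → ℚS.Polynomial n
polyℚ = fold (λ i → ℚS.con (fromℤ i)) ℚS._:+_ ℚS._:-_ ℚS._:*_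

fromℤ-⟦⟧ : ∀ e → fromℤ ⟦ e ⟧ℤ ≡ ⟦ mapᴱ fromℤ e ⟧ℚ
fromℤ-⟦⟧ (‵ a)   = refl
fromℤ-⟦⟧ (# i)   = refl
fromℤ-⟦⟧ (e ⊕ f) = trans (fromℤ-+ ⟦ e ⟧ℤ ⟦ f ⟧ℤ) (cong₂ ℚ._+_ (fromℤ-⟦⟧ e) (fromℤ-⟦⟧ f))
fromℤ-⟦⟧ (e ⊖ f) = trans (fromℤ-+ ⟦ e ⟧ℤ (ℤ.- ⟦ f ⟧ℤ))
  (cong₂ ℚ._+_ (fromℤ-⟦⟧ e) (trans (fromℤ-neg ⟦ f ⟧ℤ) (cong ℚ.-_ (fromℤ-⟦⟧ f))))
fromℤ-⟦⟧ (e ⊗ f) = trans (fromℤ-* ⟦ e ⟧ℤ ⟦ f ⟧ℤ) (cong₂ ℚ._*_ (fromℤ-⟦⟧ e) (fromℤ-⟦⟧ f))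

⟦⟧ℚ-injective : ∀ e f → ⟦ mapᴱ fromℤ e ⟧ℚ ≡ ⟦ mapᴱ fromℤ f ⟧ℚ → ⟦ e ⟧ℤ ≡ ⟦ f ⟧ℤ
⟦⟧ℚ-injective e f eq = fromℤ-injective (trans (fromℤ-⟦⟧ e) (trans eq (sym (fromℤ-⟦⟧ f))))

-- Odd numbers and exact powers of 2

Odd : ℕ → Set
Odd n = ¬ 2 ∣ n

2-prime : Prime 2
2-prime = from-yes (prime? 2)

odd-* : ∀ {m n} → Odd m → Odd n → Odd (m ℕ.* n)
odd-* {m} {n} odd-m odd-n 2∣mn = [ odd-m , odd-n ]′ (euclidsLemma m n 2-prime 2∣mn)

even-*-odd⇒even : ∀ {m o} → Odd o → 2 ∣ m ℕ.* o → 2 ∣ m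
even-*-odd⇒even {m} {o} odd-o 2∣mo = [ id , (λ 2∣o → ⊥-elim (odd-o 2∣o)) ]′ (euclidsLemma m o 2-prime 2∣mo)

odd-*ℤ : ∀ {i j} → Odd ℤ.∣ i ∣ → Odd ℤ.∣ j ∣ → Odd ℤ.∣ i ℤ.* j ∣
odd-*ℤ {i} {j} odd-i odd-j = subst Odd (sym (ℤP.abs-* i j)) (odd-* odd-i odd-j)

odd-negℤ : ∀ {i} → Odd ℤ.∣ i ∣ → Odd ℤ.∣ ℤ.- i ∣
odd-negℤ {i} = subst Odd (sym (ℤP.∣-i∣≡∣i∣ i))

odd-+-evenℤ : ∀ i j → Odd ℤ.∣ i ∣ → Odd ℤ.∣ i ℤ.+ + 2 ℤ.* j ∣
odd-+-evenℤ i j odd-i 2∣i+2j =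
  odd-i (∣⇒∣ᵤ (ℤDˢ.∣m+n∣n⇒∣m {m = i} (∣ᵤ⇒∣ 2∣i+2j) (ℤDˢ.∣m⇒∣m*n j (ℤDˢ.∣-refl {+ 2}))))

odd⇒1+2* : ∀ i → Odd ℤ.∣ i ∣ → Σ ℤ λ t → i ≡ + 1 ℤ.+ t ℤ.* + 2
odd⇒1+2* i odd-i with i ℤDM.% + 2 | ℤDM.n%d<d i (+ 2) | ℤDM.a≡a%n+[a/n]*n i (+ 2)
... | 0 | _ | i≡2q = ⊥-elim (odd-i (∣⇒∣ᵤ (ℤDˢ.divides (i ℤDM./ + 2) (trans i≡2q (ℤP.+-identityˡ _)))))
... | 1 | _ | i≡1+2q = i ℤDM./ + 2 , i≡1+2q
... | suc (suc _) | s≤s (s≤s ()) | _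

infix 4 2^_∥_

record 2^_∥_ (e n : ℕ) : Set where
  constructor exact
  field
    oddPart     : ℕ
    oddPart-odd : Odd oddPart
    factorise   : n ≡ 2 ℕ.^ e ℕ.* oddPart

odd⇒2^0∥ : ∀ {n} → Odd n → 2^ 0 ∥ n
odd⇒2^0∥ {n} odd-n = exact n odd-n (sym (ℕP.*-identityˡ n))

2^0∥⇒odd : ∀ {n} → 2^ 0 ∥ n → Odd n
2^0∥⇒odd (exact q odd-q refl) = subst Odd (sym (ℕP.*-identityˡ q)) odd-q

∥⇒≢0 : ∀ {e n} → 2^ e ∥ n → n ≢ 0
∥⇒≢0 {e} (exact q odd-q refl) 2^eq≡0 with ℕP.m*n≡0⇒m≡0∨n≡0 (2 ℕ.^ e) 2^eq≡0
... | inj₁ 2^e≡0 with () ← ℕP.m^n≡0⇒m≡0 2 e 2^e≡0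
... | inj₂ refl  = odd-q (2 ND.∣0)

2^suc∥⇒2∣ : ∀ {e n} → 2^ suc e ∥ n → 2 ∣ n
2^suc∥⇒2∣ {e} (exact q _ refl) = divides (2 ℕ.^ e ℕ.* q) (trans (ℕP.*-assoc 2 (2 ℕ.^ e) q) (ℕP.*-comm 2 (2 ℕ.^ e ℕ.* q)))

≡2^e*odd⇒∥ : ∀ e {i} n → i ≡ + (2 ℕ.^ e) ℤ.* n → Odd ℤ.∣ n ∣ → 2^ e ∥ ℤ.∣ i ∣
≡2^e*odd⇒∥ e n refl odd-n = exact ℤ.∣ n ∣ odd-n (ℤP.abs-* (+ (2 ℕ.^ e)) n)

n<2^n : ∀ n → n < 2 ℕ.^ n
n<2^n zero    = s≤s z≤n
n<2^n (suc n) = ℕP.+-mono-≤ (ℕP.m^n>0 2 n) (ℕP.≤-trans (n<2^n n) (ℕP.m≤m+n (2 ℕ.^ n) 0))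

vℕ-aux-odd : ∀ f q → Odd q → vℕ-aux (suc f) 2 q ≡ 0
vℕ-aux-odd f zero    _     = refl
vℕ-aux-odd f (suc q) odd-q with 2 ∣? suc q
... | yes 2∣q = ⊥-elim (odd-q 2∣q)
... | no  _   = refl

vℕ-aux-2* : ∀ f n → vℕ-aux (suc f) 2 (2 ℕ.* suc n) ≡ suc (vℕ-aux f 2 (suc n))
vℕ-aux-2* f n with 2 ∣? suc (n ℕ.+ suc (n ℕ.+ 0))
... | yes _ = cong (λ m → suc (vℕ-aux f 2 m)) (trans (cong (ℕ._/ 2) (ℕP.*-comm 2 (suc n))) (ℕDM.m*n/n≡m (suc n) 2))
... | no ¬2∣ = ⊥-elim (¬2∣ (divides (suc n) (ℕP.*-comm 2 (suc n))))

vℕ-aux-exact : ∀ f e q → Odd q → e < f → vℕ-aux f 2 (2 ℕ.^ e ℕ.* q) ≡ e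
vℕ-aux-exact (suc f) zero    q odd-q _ = trans (cong (vℕ-aux (suc f) 2) (ℕP.*-identityˡ q)) (vℕ-aux-odd f q odd-q)
vℕ-aux-exact (suc f) (suc e) q odd-q (s≤s e<f) rewrite ℕP.*-assoc 2 (2 ℕ.^ e) q
  with 2 ℕ.^ e ℕ.* q | ∥⇒≢0 {e} (exact q odd-q refl) | vℕ-aux-exact f e q odd-q e<f
... | zero  | ≢0 | _  = ⊥-elim (≢0 refl)
... | suc n | _  | ih = trans (vℕ-aux-2* f n) (cong suc ih)

vℕ-exact : ∀ {e n} → 2^ e ∥ n → vℕ 2 n ≡ e
vℕ-exact {e} (exact q odd-q refl) = vℕ-aux-exact (2 ℕ.^ e ℕ.* q) e q odd-q
  (ℕP.<-≤-trans (n<2^n e) (ℕP.m≤m*n (2 ℕ.^ e) q {{ℕ.≢-nonZero q≢0}}))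
  where
  q≢0 : q ≢ 0
  q≢0 refl = odd-q (2 ND.∣0)

coprime⇒¬both-even : ∀ {n d} → Coprime n d → 2 ∣ n → 2 ∣ d → ⊥
coprime⇒¬both-even coprime 2∣n 2∣d with () ← coprime (2∣n , 2∣d)

cross⇒odd-denominator : ∀ {n d o b} → Coprime n d → Odd o → n ℕ.* o ≡ d ℕ.* b → Odd d
cross⇒odd-denominator {b = b} coprime odd-o no≡db 2∣d = coprime⇒¬both-even coprime
  (even-*-odd⇒even odd-o (subst (2 ∣_) (sym no≡db) (ND.∣m⇒∣m*n b 2∣d))) 2∣d

cross-halve : ∀ {n d o b} → Coprime n d → Odd o → n ℕ.* o ≡ d ℕ.* (2 ℕ.* b) →
              Σ ℕ λ n′ → n ≡ 2 ℕ.* n′ × Coprime n′ d × n′ ℕ.* o ≡ d ℕ.* b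
cross-halve {n} {d} {o} {b} coprime odd-o no≡d2b
  with even-*-odd⇒even {n} odd-o (subst (2 ∣_) (sym no≡d2b) (ND.∣n⇒∣m*n d (ND.m∣m*n b)))
... | divides n′ refl = n′ , ℕP.*-comm n′ 2 , coprime′ , ℕP.*-cancelˡ-≡ _ _ 2 (begin
  2 ℕ.* (n′ ℕ.* o)    ≡⟨ ℕ*.x∙yz≈xy∙z 2 n′ o ⟩
  2 ℕ.* n′ ℕ.* o      ≡⟨ cong (ℕ._* o) (ℕP.*-comm 2 n′) ⟩
  n′ ℕ.* 2 ℕ.* o      ≡⟨ no≡d2b ⟩
  d ℕ.* (2 ℕ.* b)     ≡⟨ ℕ*.x∙yz≈y∙xz d 2 b ⟩
  2 ℕ.* (d ℕ.* b)     ∎)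
  where
  open ≡-Reasoning
  coprime′ : Coprime n′ d
  coprime′ (i∣n′ , i∣d) = coprime (ND.∣-trans i∣n′ (ND.m∣m*n 2) , i∣d)

cross⇒exact-numerator : ∀ e {n d o b} → Coprime n d → Odd o → 2^ e ∥ b → n ℕ.* o ≡ d ℕ.* b → 2^ e ∥ n
cross⇒exact-numerator zero coprime odd-o 2^0∥b no≡db = odd⇒2^0∥ λ 2∣n →
  cross⇒odd-denominator (NC.sym coprime) (2^0∥⇒odd 2^0∥b) (sym no≡db) 2∣n
cross⇒exact-numerator (suc e) {d = d} coprime odd-o (exact q odd-q refl) no≡db
  with cross-halve {b = 2 ℕ.^ e ℕ.* q} coprime odd-o (trans no≡db (cong (d ℕ.*_) (ℕP.*-assoc 2 (2 ℕ.^ e) q)))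
... | n′ , refl , coprime′ , n′o≡db′ with cross⇒exact-numerator e coprime′ odd-o (exact q odd-q refl) n′o≡db′
... | exact r odd-r refl = exact r odd-r (sym (ℕP.*-assoc 2 (2 ℕ.^ e) r))

cross⇒exact-≤ : ∀ {a b n d p q} → a ℕ.≤ b → Coprime n d → 2^ a ∥ p → 2^ b ∥ q → n ℕ.* p ≡ d ℕ.* q →
                2^ (b ℕ.∸ a) ∥ n × Odd d
cross⇒exact-≤ {a} {b} {n} {d} a≤b coprime (exact o₁ odd-o₁ refl) (exact o₂ odd-o₂ refl) np≡dq =
  cross⇒exact-numerator (b ℕ.∸ a) coprime odd-o₁ (exact o₂ odd-o₂ refl) cancelled ,
  cross⇒odd-denominator coprime odd-o₁ cancelled
  where
  open ≡-Reasoning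
  rearrange : ∀ d x y o → d ℕ.* (x ℕ.* y ℕ.* o) ≡ d ℕ.* (y ℕ.* o) ℕ.* x
  rearrange = ℕSolver.solve-∀
  cancelled : n ℕ.* o₁ ≡ d ℕ.* (2 ℕ.^ (b ℕ.∸ a) ℕ.* o₂)
  cancelled = ℕP.*-cancelʳ-≡ _ _ (2 ℕ.^ a) {{ℕP.m^n≢0 2 a}} (begin
    n ℕ.* o₁ ℕ.* 2 ℕ.^ a                              ≡⟨ ℕ*.xy∙z≈x∙zy n o₁ (2 ℕ.^ a) ⟩
    n ℕ.* (2 ℕ.^ a ℕ.* o₁)                            ≡⟨ np≡dq ⟩
    d ℕ.* (2 ℕ.^ b ℕ.* o₂)                            ≡⟨ cong (λ k → d ℕ.* (2 ℕ.^ k ℕ.* o₂)) (ℕP.m+[n∸m]≡n a≤b) ⟨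
    d ℕ.* (2 ℕ.^ (a ℕ.+ (b ℕ.∸ a)) ℕ.* o₂)            ≡⟨ cong (λ k → d ℕ.* (k ℕ.* o₂)) (ℕP.^-distribˡ-+-* 2 a (b ℕ.∸ a)) ⟩
    d ℕ.* (2 ℕ.^ a ℕ.* 2 ℕ.^ (b ℕ.∸ a) ℕ.* o₂)        ≡⟨ rearrange d (2 ℕ.^ a) (2 ℕ.^ (b ℕ.∸ a)) o₂ ⟩
    d ℕ.* (2 ℕ.^ (b ℕ.∸ a) ℕ.* o₂) ℕ.* 2 ℕ.^ a        ∎)

cross⇒exact : ∀ {a b n d p q} → Coprime n d → 2^ a ∥ p → 2^ b ∥ q → n ℕ.* p ≡ d ℕ.* q →
              2^ (b ℕ.∸ a) ∥ n × 2^ (a ℕ.∸ b) ∥ d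
cross⇒exact {a} {b} {n} {d} coprime 2^a∥p 2^b∥q np≡dq with ℕP.≤-total a b
... | inj₁ a≤b = proj₁ result , subst (λ e → 2^ e ∥ d) (sym (ℕP.m≤n⇒m∸n≡0 a≤b)) (odd⇒2^0∥ (proj₂ result))
  where result = cross⇒exact-≤ a≤b coprime 2^a∥p 2^b∥q np≡dq
... | inj₂ b≤a = subst (λ e → 2^ e ∥ n) (sym (ℕP.m≤n⇒m∸n≡0 b≤a)) (odd⇒2^0∥ (proj₂ result)) , proj₁ result
  where result = cross⇒exact-≤ b≤a (NC.sym coprime) 2^b∥q 2^a∥p (sym np≡dq)

TwoAdicShape : ℕ → ℕ → ℚ → Set
TwoAdicShape a b X = 2^ a ∥ ℤ.∣ ↥ X ∣ × 2^ b ∥ ↧ₙ X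

shape⇒vℚ : ∀ {a b X} → TwoAdicShape a b X → vℚ 2 X ≡ + a ℤ.- + b
shape⇒vℚ (2^a∥↥X , 2^b∥↧X) = cong₂ (λ i j → + i ℤ.- + j) (vℕ-exact 2^a∥↥X) (vℕ-exact 2^b∥↧X)

shape⇒≢0 : ∀ {a b X} → TwoAdicShape a b X → X ≢ 0ℚ
shape⇒≢0 (2^a∥↥X , _) refl = ∥⇒≢0 2^a∥↥X refl

shape⇒non-integral : ∀ {a b X} → TwoAdicShape a (suc b) X → ↧ₙ X ≢ 1
shape⇒non-integral (_ , 2^b∥↧X) ↧X≡1 with () ← ND.∣1⇒≡1 (subst (2 ∣_) ↧X≡1 (2^suc∥⇒2∣ 2^b∥↧X))

cross⇒shape : ∀ X {D N a b} → ↥ X ℤ.* D ≡ ↧ X ℤ.* N → 2^ a ∥ ℤ.∣ D ∣ → 2^ b ∥ ℤ.∣ N ∣ →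
              TwoAdicShape (b ℕ.∸ a) (a ℕ.∸ b) X
cross⇒shape X@(mkℚ _ _ coprime) {D} {N} XD≡N 2^a∥D 2^b∥N =
  cross⇒exact (NC.recompute coprime) 2^a∥D 2^b∥N
    (trans (sym (ℤP.abs-* (↥ X) D)) (trans (cong ℤ.∣_∣ XD≡N) (ℤP.abs-* (↧ X) N)))

coprime-∣^⇒≡1 : ∀ {c a} n → Coprime c a → c ∣ a ℕ.^ n → c ≡ 1
coprime-∣^⇒≡1 zero    _       c∣1     = ND.∣1⇒≡1 c∣1
coprime-∣^⇒≡1 (suc n) coprime c∣aaⁿ = coprime-∣^⇒≡1 n coprime (NC.coprime-divisor coprime c∣aaⁿ)

∣i^n∣≡∣i∣^n : ∀ i n → ℤ.∣ i ℤ.^ n ∣ ≡ ℤ.∣ i ∣ ℕ.^ n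
∣i^n∣≡∣i∣^n i zero    = refl
∣i^n∣≡∣i∣^n i (suc n) = trans (ℤP.abs-* i (i ℤ.^ n)) (cong (ℤ.∣ i ∣ ℕ.*_) (∣i^n∣≡∣i∣^n i n))

-- Doubling on y² = x³ + A x + B

2ℚ 4ℚ 8ℚ : ℚ
2ℚ = fromℤ (+ 2)
4ℚ = fromℤ (+ 4)
8ℚ = fromℤ (+ 8)

slopeᴱ : ∀ {V : Set} → Expr V → Expr V → Expr V
slopeᴱ A x = # + 3 ⊗ x ⊗ x ⊕ A

cubicᴱ : ∀ {V : Set} → Expr V → Expr V → Expr V → Expr V
cubicᴱ A B x = x ⊗ x ⊗ x ⊕ A ⊗ x ⊕ B

doubling-numeratorᴱ : ∀ {V : Set} → Expr V → Expr V → Expr V → Expr V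
doubling-numeratorᴱ A B x = slopeᴱ A x ⊗ slopeᴱ A x ⊖ # + 8 ⊗ x ⊗ cubicᴱ A B x

slope-numerator : ℤ → ℚ → ℚ
slope-numerator A x = ⟦ slopeᴱ (# A) (‵ x) ⟧ℚ

cubic : ℤ → ℤ → ℚ → ℚ
cubic A B x = ⟦ cubicᴱ (# A) (# B) (‵ x) ⟧ℚ

doubling-numerator : ℤ → ℤ → ℚ → ℚ
doubling-numerator A B x = ⟦ doubling-numeratorᴱ (# A) (# B) (‵ x) ⟧ℚ

slopeℤ : ℤ → ℤ → ℤ
slopeℤ A x = ⟦ slopeᴱ (# A) (# x) ⟧ℤ

cubicℤ : ℤ → ℤ → ℤ → ℤ
cubicℤ A B x = ⟦ cubicᴱ (# A) (# B) (# x) ⟧ℤ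

doubling-numeratorℤ : ℤ → ℤ → ℤ → ℤ
doubling-numeratorℤ A B x = ⟦ doubling-numeratorᴱ (# A) (# B) (# x) ⟧ℤ

OnCurve : ℤ → ℤ → Point → Set
OnCurve A B ∞         = ⊤
OnCurve A B (aff x y) = y ℚ.* y ≡ cubic A B x

integral-onCurve : ∀ A B x y → y ℤ.* y ≡ cubicℤ A B x → OnCurve A B (aff (fromℤ x) (fromℤ y))
integral-onCurve A B x y y²≡fx = trans (sym (fromℤ-* y y)) (trans (cong fromℤ y²≡fx) (fromℤ-⟦⟧ (cubicᴱ (# A) (# B) (# x))))

data Doubling (A : ℤ) (x y : ℚ) : Point → Set where
  vertical : y ≡ 0ℚ → Doubling A x y ∞
  tangent  : ∀ s → 2ℚ ℚ.* y ℚ.* s ≡ slope-numerator A x →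
             Doubling A x y (aff (s ℚ.* s ℚ.- 2ℚ ℚ.* x) (s ℚ.* (x ℚ.- (s ℚ.* s ℚ.- 2ℚ ℚ.* x)) ℚ.- y))

doubling : ∀ A x y → Doubling A x y (double A (aff x y))
doubling A x y with y ℚP.≟ 0ℚ
... | yes y≡0 = vertical y≡0
... | no  y≢0 = tangent _ (begin
  2ℚ ℚ.* y ℚ.* ((n ℚ.* ½) ℚ.* ℚ.1/ y)   ≡⟨ solve 5 (λ t y n h w → t :* y :* ((n :* h) :* w) := n :* (w :* y) :* (t :* h))
                                               refl 2ℚ y n ½ (ℚ.1/ y) ⟩
  n ℚ.* (ℚ.1/ y ℚ.* y) ℚ.* (2ℚ ℚ.* ½)  ≡⟨ cong (λ u → n ℚ.* u ℚ.* (2ℚ ℚ.* ½)) (ℚP.*-inverseˡ y) ⟩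
  n ℚ.* 1ℚ ℚ.* 1ℚ                      ≡⟨ trans (ℚP.*-identityʳ _) (ℚP.*-identityʳ n) ⟩
  n                                    ∎)
  where
  open ≡-Reasoning
  open ℚS
  instance _ = ℚ.≢-nonZero y≢0
  n = slope-numerator A x

double≡∞⇒y≡0 : ∀ A x y → double A (aff x y) ≡ ∞ → y ≡ 0ℚ
double≡∞⇒y≡0 A x y 2P≡∞ with double A (aff x y) | doubling A x y
double≡∞⇒y≡0 A x y refl | ∞ | vertical y≡0 = y≡0

tangent-x : ∀ A x y s → 2ℚ ℚ.* y ℚ.* s ≡ slope-numerator A x →
            (s ℚ.* s ℚ.- 2ℚ ℚ.* x) ℚ.* (4ℚ ℚ.* (y ℚ.* y))
              ≡ slope-numerator A x ℚ.* slope-numerator A x ℚ.- 8ℚ ℚ.* x ℚ.* (y ℚ.* y)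
tangent-x A x y s 2ys≡n = begin
  (s ℚ.* s ℚ.- 2ℚ ℚ.* x) ℚ.* (4ℚ ℚ.* (y ℚ.* y))
    ≡⟨ solve 3 (λ s x y → (s :* s :- con 2ℚ :* x) :* (con 4ℚ :* (y :* y))
                 := (con 2ℚ :* y :* s) :* (con 2ℚ :* y :* s) :- con 8ℚ :* x :* (y :* y)) refl s x y ⟩
  (2ℚ ℚ.* y ℚ.* s) ℚ.* (2ℚ ℚ.* y ℚ.* s) ℚ.- 8ℚ ℚ.* x ℚ.* (y ℚ.* y)
    ≡⟨ cong (λ u → u ℚ.* u ℚ.- 8ℚ ℚ.* x ℚ.* (y ℚ.* y)) 2ys≡n ⟩
  slope-numerator A x ℚ.* slope-numerator A x ℚ.- 8ℚ ℚ.* x ℚ.* (y ℚ.* y) ∎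
  where
  open ≡-Reasoning
  open ℚS

tangent-onCurve : ∀ A B x y s → y ℚ.* y ≡ cubic A B x → 2ℚ ℚ.* y ℚ.* s ≡ slope-numerator A x →
                  OnCurve A B (aff (s ℚ.* s ℚ.- 2ℚ ℚ.* x) (s ℚ.* (x ℚ.- (s ℚ.* s ℚ.- 2ℚ ℚ.* x)) ℚ.- y))
tangent-onCurve A B x y s y²≡fx 2ys≡n = x∙y⁻¹≈ε⇒x≈y (Y ℚ.* Y) (cubic A B X) (begin
  Y ℚ.* Y ℚ.- cubic A B X
    ≡⟨ solve 5 (λ s x y a b →
         let X = s :* s :- con 2ℚ :* x ; Y = s :* (x :- X) :- y in
         Y :* Y :- polyℚ (cubicᴱ (‵ a) (‵ b) (‵ X))
         := (con 2ℚ :* y :* s :- polyℚ (slopeᴱ (‵ a) (‵ x))) :* (X :- x) :+ (y :* y :- polyℚ (cubicᴱ (‵ a) (‵ b) (‵ x))))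
         refl s x y (fromℤ A) (fromℤ B) ⟩
  (2ℚ ℚ.* y ℚ.* s ℚ.- slope-numerator A x) ℚ.* (X ℚ.- x) ℚ.+ (y ℚ.* y ℚ.- cubic A B x)
    ≡⟨ cong₂ (λ u v → u ℚ.* (X ℚ.- x) ℚ.+ v) (x≈y⇒x∙y⁻¹≈ε 2ys≡n) (x≈y⇒x∙y⁻¹≈ε y²≡fx) ⟩
  0ℚ ℚ.* (X ℚ.- x) ℚ.+ 0ℚ
    ≡⟨ trans (ℚP.+-identityʳ _) (ℚP.*-zeroˡ (X ℚ.- x)) ⟩
  0ℚ ∎)
  where
  open ≡-Reasoning
  open ℚS
  X = s ℚ.* s ℚ.- 2ℚ ℚ.* x
  Y = s ℚ.* (x ℚ.- X) ℚ.- y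

double-onCurve : ∀ A B P → OnCurve A B P → OnCurve A B (double A P)
double-onCurve A B ∞         _       = tt
double-onCurve A B (aff x y) y²≡fx with double A (aff x y) | doubling A x y
... | ∞ | vertical _       = tt
... | _ | tangent s 2ys≡n = tangent-onCurve A B x y s y²≡fx 2ys≡n

double-x : ∀ A B x y {X Y} → OnCurve A B (aff x y) → double A (aff x y) ≡ aff X Y →
           X ℚ.* (4ℚ ℚ.* cubic A B x) ≡ doubling-numerator A B x
double-x A B x y y²≡fx 2P≡XY with double A (aff x y) | doubling A x y
double-x A B x y y²≡fx ()   | ∞ | vertical _
double-x A B x y y²≡fx refl | _ | tangent s 2ys≡n =
  subst (λ w → (s ℚ.* s ℚ.- 2ℚ ℚ.* x) ℚ.* (4ℚ ℚ.* w) ≡ slope-numerator A x ℚ.* slope-numerator A x ℚ.- 8ℚ ℚ.* x ℚ.* w)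
        y²≡fx (tangent-x A x y s 2ys≡n)

FractionalX : Point → Set
FractionalX ∞         = ⊤
FractionalX (aff x _) = ↧ₙ x ≢ 1

fractionalX⇒¬integral : ∀ P → FractionalX P → ¬ IsIntegral P
fractionalX⇒¬integral (aff _ _) ↧x≢1 (a , _ , refl , _) = ↧x≢1 (↧ₙ-fromℤ a)

fourthᴱ : ∀ {V : Set} → Expr V → Expr V
fourthᴱ u = u ⊗ (u ⊗ (u ⊗ (u ⊗ # + 1)))

integral-double⇒integral : ∀ A B x y z {Y} → OnCurve A B (aff x y) → double A (aff x y) ≡ aff (fromℤ z) Y →
                           ↧ₙ x ≡ 1
integral-double⇒integral A B x@(mkℚ a _ coprime) y z y²≡fx 2P≡zY =
  coprime-∣^⇒≡1 4 (NC.sym (NC.recompute coprime)) (divides ℤ.∣ W ∣ (begin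
    ℤ.∣ a ∣ ℕ.^ 4         ≡⟨ ∣i^n∣≡∣i∣^n a 4 ⟨
    ℤ.∣ a ℤ.^ 4 ∣         ≡⟨ cong ℤ.∣_∣ a⁴≡cW ⟩
    ℤ.∣ c ℤ.* W ∣         ≡⟨ ℤP.abs-* c W ⟩
    ↧ₙ x ℕ.* ℤ.∣ W ∣      ≡⟨ ℕP.*-comm (↧ₙ x) ℤ.∣ W ∣ ⟩
    ℤ.∣ W ∣ ℕ.* ↧ₙ x      ∎))
  where
  open ≡-Reasoning
  open ℚS
  c = ↧ x
  -- with u = x c, the equation z · 4f(x) = N(x) scaled by c⁴ reads u⁴ = c W
  Wᴱ : ∀ {V : Set} → Expr V → Expr V → Expr V → Expr V → Expr V → Expr V
  Wᴱ u c z A B = # + 4 ⊗ z ⊗ (u ⊗ u ⊗ u ⊕ A ⊗ u ⊗ (c ⊗ c) ⊕ B ⊗ (c ⊗ c ⊗ c))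
    ⊕ # + 2 ⊗ A ⊗ u ⊗ u ⊗ c ⊕ # + 8 ⊗ B ⊗ u ⊗ (c ⊗ c) ⊖ A ⊗ A ⊗ (c ⊗ c ⊗ c)
  W = ⟦ Wᴱ (# a) (# c) (# z) (# A) (# B) ⟧ℤ
  scaled : ∀ x c z A B → ⟦ fourthᴱ (‵ (x ℚ.* c)) ⟧ℚ
    ≡ c ℚ.* ⟦ Wᴱ (‵ (x ℚ.* c)) (‵ c) (‵ z) (‵ A) (‵ B) ⟧ℚ ℚ.+ c ℚ.* c ℚ.* c ℚ.* c ℚ.*
        (⟦ doubling-numeratorᴱ (‵ A) (‵ B) (‵ x) ⟧ℚ ℚ.- z ℚ.* (4ℚ ℚ.* ⟦ cubicᴱ (‵ A) (‵ B) (‵ x) ⟧ℚ))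
  scaled = solve 5 (λ x c z A B → polyℚ (fourthᴱ (‵ (x :* c)))
    := c :* polyℚ (Wᴱ (‵ (x :* c)) (‵ c) (‵ z) (‵ A) (‵ B)) :+ c :* c :* c :* c :*
         (polyℚ (doubling-numeratorᴱ (‵ A) (‵ B) (‵ x)) :- z :* (con 4ℚ :* polyℚ (cubicᴱ (‵ A) (‵ B) (‵ x))))) refl
  Wq : ℚ → ℚ
  Wq u = ⟦ Wᴱ (‵ u) (# c) (# z) (# A) (# B) ⟧ℚ
  c⁴ = fromℤ c ℚ.* fromℤ c ℚ.* fromℤ c ℚ.* fromℤ c
  a⁴≡cW : a ℤ.^ 4 ≡ c ℤ.* W
  a⁴≡cW = ⟦⟧ℚ-injective (fourthᴱ (# a)) (# c ⊗ Wᴱ (# a) (# c) (# z) (# A) (# B)) (begin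
    ⟦ fourthᴱ (‵ fromℤ a) ⟧ℚ
      ≡⟨ cong (λ u → ⟦ fourthᴱ (‵ u) ⟧ℚ) (*-fromℤ-↧ x) ⟨
    ⟦ fourthᴱ (‵ (x ℚ.* fromℤ c)) ⟧ℚ
      ≡⟨ scaled x (fromℤ c) (fromℤ z) (fromℤ A) (fromℤ B) ⟩
    fromℤ c ℚ.* Wq (x ℚ.* fromℤ c) ℚ.+ c⁴ ℚ.* (doubling-numerator A B x ℚ.- fromℤ z ℚ.* (4ℚ ℚ.* cubic A B x))
      ≡⟨ cong (λ t → fromℤ c ℚ.* Wq (x ℚ.* fromℤ c) ℚ.+ c⁴ ℚ.* t) (x≈y⇒x∙y⁻¹≈ε (sym (double-x A B x y y²≡fx 2P≡zY))) ⟩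
    fromℤ c ℚ.* Wq (x ℚ.* fromℤ c) ℚ.+ c⁴ ℚ.* 0ℚ
      ≡⟨ trans (cong (fromℤ c ℚ.* Wq (x ℚ.* fromℤ c) ℚ.+_) (ℚP.*-zeroʳ c⁴)) (ℚP.+-identityʳ _) ⟩
    fromℤ c ℚ.* Wq (x ℚ.* fromℤ c)
      ≡⟨ cong (λ u → fromℤ c ℚ.* Wq u) (*-fromℤ-↧ x) ⟩
    fromℤ c ℚ.* Wq (fromℤ a) ∎)

double-fractionalX : ∀ A B P → OnCurve A B P → FractionalX P → FractionalX (double A P)
double-fractionalX A B ∞         _      _     = tt
double-fractionalX A B (aff x y) y²≡fx ↧x≢1 with double A (aff x y) in 2P≡XY
... | ∞       = tt
... | aff X Y = λ ↧X≡1 → ↧x≢1 (integral-double⇒integral A B x y (↥ X) y²≡fx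
                  (trans 2P≡XY (cong (λ X → aff X Y) (↧ₙ≡1⇒≡fromℤ X ↧X≡1))))

mul2-fractional⇒mul4 : ∀ A B P → OnCurve A B P → FractionalX (mul2 A P) → FractionalX (mul4 A P)
mul2-fractional⇒mul4 A B P on = double-fractionalX A B (mul2 A P) (double-onCurve A B P on)

mul4-fractional⇒mul8 : ∀ A B P → OnCurve A B P → FractionalX (mul4 A P) → FractionalX (mul8 A P)
mul4-fractional⇒mul8 A B P on = mul2-fractional⇒mul4 A B (mul2 A P) (double-onCurve A B P on)

DoubleShape : ℤ → Point → ℕ → ℕ → Set
DoubleShape A P a b = Σ ℚ λ X → Σ ℚ λ Y → double A P ≡ aff X Y × TwoAdicShape a b X

double-integral : ∀ A B x y {a b} → OnCurve A B (aff (fromℤ x) y) →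
                  2^ a ∥ ℤ.∣ + 4 ℤ.* cubicℤ A B x ∣ → 2^ b ∥ ℤ.∣ doubling-numeratorℤ A B x ∣ →
                  DoubleShape A (aff (fromℤ x) y) (b ℕ.∸ a) (a ℕ.∸ b)
double-integral A B x y y²≡fx 2^a∥4f 2^b∥N with double A (aff (fromℤ x) y) in 2P≡
... | ∞       = ⊥-elim (∥⇒≢0 2^a∥4f (cong (λ f → ℤ.∣ + 4 ℤ.* f ∣) f≡0))
  where
  f≡0 : cubicℤ A B x ≡ + 0
  f≡0 = fromℤ-injective (begin
    fromℤ (cubicℤ A B x)    ≡⟨ fromℤ-⟦⟧ (cubicᴱ (# A) (# B) (# x)) ⟩
    cubic A B (fromℤ x)      ≡⟨ y²≡fx ⟨
    y ℚ.* y                  ≡⟨ cong (λ y → y ℚ.* y) (double≡∞⇒y≡0 A (fromℤ x) y 2P≡) ⟩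
    0ℚ                       ∎)
    where open ≡-Reasoning
... | aff X Y = X , Y , refl , cross⇒shape X (cross-multiply X (+ 4 ℤ.* cubicℤ A B x) (doubling-numeratorℤ A B x) X·4f≡N) 2^a∥4f 2^b∥N
  where
  X·4f≡N : X ℚ.* fromℤ (+ 4 ℤ.* cubicℤ A B x) ≡ fromℤ (doubling-numeratorℤ A B x)
  X·4f≡N = trans (cong (X ℚ.*_) (fromℤ-⟦⟧ (# + 4 ⊗ cubicᴱ (# A) (# B) (# x))))
                 (trans (double-x A B (fromℤ x) y y²≡fx 2P≡) (sym (fromℤ-⟦⟧ (doubling-numeratorᴱ (# A) (# B) (# x)))))

shape⇒double-fractional : ∀ {A P a b} → DoubleShape A P a (suc b) → FractionalX (double A P)
shape⇒double-fractional (X , Y , 2P≡XY , shape) = subst FractionalX (sym 2P≡XY) (shape⇒non-integral {X = X} shape)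

shape⇒double-onCurve : ∀ A B {P a b} → OnCurve A B P → ((X , Y , _) : DoubleShape A P a b) → OnCurve A B (aff X Y)
shape⇒double-onCurve A B {P} on (X , Y , 2P≡XY , _) = subst (OnCurve A B) 2P≡XY (double-onCurve A B P on)

numerator-odd : ∀ A B x → Odd ℤ.∣ slopeℤ A x ∣ → Odd ℤ.∣ doubling-numeratorℤ A B x ∣
numerator-odd A B x odd-s = subst (λ i → Odd ℤ.∣ i ∣) (sym (form A B x))
  (odd-+-evenℤ (slopeℤ A x ℤ.* slopeℤ A x) (ℤ.- (+ 4 ℤ.* x ℤ.* cubicℤ A B x)) (odd-*ℤ {slopeℤ A x} {slopeℤ A x} odd-s odd-s))
  where
  open ℤS
  form : ∀ A B x → doubling-numeratorℤ A B x
                   ≡ slopeℤ A x ℤ.* slopeℤ A x ℤ.+ + 2 ℤ.* (ℤ.- (+ 4 ℤ.* x ℤ.* cubicℤ A B x))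
  form = solve 3 (λ A B x → polyℤ (doubling-numeratorᴱ (‵ A) (‵ B) (‵ x))
    := polyℤ (slopeᴱ (‵ A) (‵ x)) :* polyℤ (slopeᴱ (‵ A) (‵ x))
       :+ con (+ 2) :* (:- (con (+ 4) :* x :* polyℤ (cubicᴱ (‵ A) (‵ B) (‵ x))))) refl

-- The curve y² = x³ − 3k²l² x + k²l²(k² + l²)

A₀ᴱ : ∀ {V : Set} → Expr V → Expr V
A₀ᴱ m = # (ℤ.- + 12) ⊗ m ⊗ m

B₀ᴱ : ∀ {V : Set} → Expr V → Expr V → Expr V
B₀ᴱ m c = # + 4 ⊗ m ⊗ m ⊗ c

A₀ : ℤ → ℤ
A₀ m = ⟦ A₀ᴱ (# m) ⟧ℤ

B₀ : ℤ → ℤ → ℤ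
B₀ m c = ⟦ B₀ᴱ (# m) (# c) ⟧ℤ

NormalForm : ℤ → ℤ → Set
NormalForm A B = Σ ℤ λ m → Σ ℤ λ c → Odd ℤ.∣ m ∣ × Odd ℤ.∣ c ∣ × A ≡ A₀ m × B ≡ B₀ m c

squarefree-even⇒2^1∥ : ∀ {k} → SquareFree k → 2 ∣ k → 2^ 1 ∥ k
squarefree-even⇒2^1∥ squarefree (divides q refl) = exact q odd-q (ℕP.*-comm q 2)
  where
  odd-q : Odd q
  odd-q (divides r refl) with () ← squarefree 2 (divides r (ℕP.*-assoc r 2 2))

normal-form-even : ∀ k l → Coprime k l → SquareFree k → 2 ∣ k → NormalForm (coefA k l) (coefB k l)
normal-form-even k l coprime squarefree 2∣k with squarefree-even⇒2^1∥ squarefree 2∣k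
... | exact q odd-q refl =
  + q ℤ.* + l , + l ℤ.* + l ℤ.+ + 2 ℤ.* (+ 2 ℤ.* (+ q ℤ.* + q)) ,
  odd-*ℤ {+ q} {+ l} odd-q odd-l , odd-+-evenℤ (+ l ℤ.* + l) _ (odd-*ℤ {+ l} {+ l} odd-l odd-l) ,
  trans (cong (λ K → ℤ.- (+ 3 ℤ.* (K ℤ.* K) ℤ.* (+ l ℤ.* + l))) (ℤP.pos-* 2 q)) (formA (+ q) (+ l)) ,
  trans (cong (λ K → K ℤ.* K ℤ.* (+ l ℤ.* + l) ℤ.* (K ℤ.* K ℤ.+ + l ℤ.* + l)) (ℤP.pos-* 2 q)) (formB (+ q) (+ l))
  where
  open ℤS
  odd-l : Odd l
  odd-l = coprime⇒¬both-even coprime 2∣k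
  formA : ∀ Q L → ℤ.- (+ 3 ℤ.* ((+ 2 ℤ.* Q) ℤ.* (+ 2 ℤ.* Q)) ℤ.* (L ℤ.* L)) ≡ A₀ (Q ℤ.* L)
  formA = solve 2 (λ Q L → :- (con (+ 3) :* ((con (+ 2) :* Q) :* (con (+ 2) :* Q)) :* (L :* L))
    := polyℤ (A₀ᴱ (‵ (Q :* L)))) refl
  formB : ∀ Q L → (+ 2 ℤ.* Q) ℤ.* (+ 2 ℤ.* Q) ℤ.* (L ℤ.* L) ℤ.* ((+ 2 ℤ.* Q) ℤ.* (+ 2 ℤ.* Q) ℤ.+ L ℤ.* L)
                  ≡ B₀ (Q ℤ.* L) (L ℤ.* L ℤ.+ + 2 ℤ.* (+ 2 ℤ.* (Q ℤ.* Q)))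
  formB = solve 2 (λ Q L → (con (+ 2) :* Q) :* (con (+ 2) :* Q) :* (L :* L) :* ((con (+ 2) :* Q) :* (con (+ 2) :* Q) :+ L :* L)
    := polyℤ (B₀ᴱ (‵ (Q :* L)) (‵ (L :* L :+ con (+ 2) :* (con (+ 2) :* (Q :* Q)))))) refl

normal-form : ∀ k l → Coprime k l → SquareFree k → SquareFree l → 2 ∣ k ⊎ 2 ∣ l → NormalForm (coefA k l) (coefB k l)
normal-form k l coprime squarefree-k _ (inj₁ 2∣k) = normal-form-even k l coprime squarefree-k 2∣k
normal-form k l coprime _ squarefree-l (inj₂ 2∣l) =
  subst₂ NormalForm (symmetric (+ l) (+ k)) (symmetricB (+ l) (+ k)) (normal-form-even l k (NC.sym coprime) squarefree-l 2∣l)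
  where
  symmetric : ∀ K L → ℤ.- (+ 3 ℤ.* (K ℤ.* K) ℤ.* (L ℤ.* L)) ≡ ℤ.- (+ 3 ℤ.* (L ℤ.* L) ℤ.* (K ℤ.* K))
  symmetric = ℤSolver.solve-∀
  symmetricB : ∀ K L → K ℤ.* K ℤ.* (L ℤ.* L) ℤ.* (K ℤ.* K ℤ.+ L ℤ.* L) ≡ L ℤ.* L ℤ.* (K ℤ.* K) ℤ.* (L ℤ.* L ℤ.+ K ℤ.* K)
  symmetricB = ℤSolver.solve-∀

slope-odd : ∀ m x → Odd ℤ.∣ x ∣ → Odd ℤ.∣ slopeℤ (A₀ m) x ∣
slope-odd m x odd-x = subst (λ i → Odd ℤ.∣ i ∣) (sym (form m x))
  (odd-+-evenℤ (x ℤ.* x) (x ℤ.* x ℤ.- + 6 ℤ.* (m ℤ.* m)) (odd-*ℤ {x} {x} odd-x odd-x))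
  where
  open ℤS
  form : ∀ m x → slopeℤ (A₀ m) x ≡ x ℤ.* x ℤ.+ + 2 ℤ.* (x ℤ.* x ℤ.- + 6 ℤ.* (m ℤ.* m))
  form = solve 2 (λ m x → polyℤ (slopeᴱ (A₀ᴱ (‵ m)) (‵ x))
    := x :* x :+ con (+ 2) :* (x :* x :- con (+ 6) :* (m :* m))) refl

cubic-odd : ∀ m c x → Odd ℤ.∣ x ∣ → Odd ℤ.∣ cubicℤ (A₀ m) (B₀ m c) x ∣
cubic-odd m c x odd-x = subst (λ i → Odd ℤ.∣ i ∣) (sym (form m c x))
  (odd-+-evenℤ (x ℤ.* x ℤ.* x) (+ 2 ℤ.* (m ℤ.* m) ℤ.* (c ℤ.- + 3 ℤ.* x))
    (odd-*ℤ {x ℤ.* x} {x} (odd-*ℤ {x} {x} odd-x odd-x) odd-x))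
  where
  open ℤS
  form : ∀ m c x → cubicℤ (A₀ m) (B₀ m c) x ≡ x ℤ.* x ℤ.* x ℤ.+ + 2 ℤ.* (+ 2 ℤ.* (m ℤ.* m) ℤ.* (c ℤ.- + 3 ℤ.* x))
  form = solve 3 (λ m c x → polyℤ (cubicᴱ (A₀ᴱ (‵ m)) (B₀ᴱ (‵ m) (‵ c)) (‵ x))
    := x :* x :* x :+ con (+ 2) :* (con (+ 2) :* (m :* m) :* (c :- con (+ 3) :* x))) refl

2^4∥4cubic[2u] : ∀ m c u → Odd ℤ.∣ m ∣ → Odd ℤ.∣ c ∣ → 2^ 4 ∥ ℤ.∣ + 4 ℤ.* cubicℤ (A₀ m) (B₀ m c) (+ 2 ℤ.* u) ∣
2^4∥4cubic[2u] m c u odd-m odd-c = ≡2^e*odd⇒∥ 4 f (form m c u)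
  (odd-+-evenℤ (m ℤ.* m ℤ.* c) _ (odd-*ℤ {m ℤ.* m} {c} (odd-*ℤ {m} {m} odd-m odd-m) odd-c))
  where
  open ℤS
  f = m ℤ.* m ℤ.* c ℤ.+ + 2 ℤ.* (u ℤ.* u ℤ.* u ℤ.- + 3 ℤ.* (m ℤ.* m) ℤ.* u)
  form : ∀ m c u → + 4 ℤ.* cubicℤ (A₀ m) (B₀ m c) (+ 2 ℤ.* u)
                   ≡ + 16 ℤ.* (m ℤ.* m ℤ.* c ℤ.+ + 2 ℤ.* (u ℤ.* u ℤ.* u ℤ.- + 3 ℤ.* (m ℤ.* m) ℤ.* u))
  form = solve 3 (λ m c u → polyℤ (# + 4 ⊗ cubicᴱ (A₀ᴱ (‵ m)) (B₀ᴱ (‵ m) (‵ c)) (# + 2 ⊗ ‵ u))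
    := con (+ 16) :* (m :* m :* c :+ con (+ 2) :* (u :* u :* u :- con (+ 3) :* (m :* m) :* u))) refl

odd²+3odd² : ∀ u m → Odd ℤ.∣ u ∣ → Odd ℤ.∣ m ∣ → Σ ℤ λ s → u ℤ.* u ℤ.+ + 3 ℤ.* (m ℤ.* m) ≡ + 4 ℤ.* s
odd²+3odd² u m odd-u odd-m with odd⇒1+2* u odd-u | odd⇒1+2* m odd-m
... | a , refl | b , refl = + 1 ℤ.+ a ℤ.+ a ℤ.* a ℤ.+ + 3 ℤ.* b ℤ.+ + 3 ℤ.* (b ℤ.* b) , form a b
  where
  form : ∀ a b → (+ 1 ℤ.+ a ℤ.* + 2) ℤ.* (+ 1 ℤ.+ a ℤ.* + 2) ℤ.+ + 3 ℤ.* ((+ 1 ℤ.+ b ℤ.* + 2) ℤ.* (+ 1 ℤ.+ b ℤ.* + 2))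
                 ≡ + 4 ℤ.* (+ 1 ℤ.+ a ℤ.+ a ℤ.* a ℤ.+ + 3 ℤ.* b ℤ.+ + 3 ℤ.* (b ℤ.* b))
  form = ℤSolver.solve-∀

2^6∥numerator[2u] : ∀ m c u → Odd ℤ.∣ m ∣ → Odd ℤ.∣ c ∣ → Odd ℤ.∣ u ∣ →
                      2^ 6 ∥ ℤ.∣ doubling-numeratorℤ (A₀ m) (B₀ m c) (+ 2 ℤ.* u) ∣
2^6∥numerator[2u] m c u odd-m odd-c odd-u with odd²+3odd² u m odd-u odd-m
... | s , u²+3m²≡4s = ≡2^e*odd⇒∥ 6 (ℤ.- (m ℤ.* m ℤ.* c ℤ.* u) ℤ.+ + 2 ℤ.* (+ 2 ℤ.* (s ℤ.* s)))
  (begin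
    doubling-numeratorℤ (A₀ m) (B₀ m c) (+ 2 ℤ.* u)
      ≡⟨ form₁ m c u ⟩
    + 16 ℤ.* ((u ℤ.* u ℤ.+ + 3 ℤ.* (m ℤ.* m)) ℤ.* (u ℤ.* u ℤ.+ + 3 ℤ.* (m ℤ.* m))) ℤ.- + 64 ℤ.* (m ℤ.* m ℤ.* c ℤ.* u)
      ≡⟨ cong (λ t → + 16 ℤ.* (t ℤ.* t) ℤ.- + 64 ℤ.* (m ℤ.* m ℤ.* c ℤ.* u)) u²+3m²≡4s ⟩
    + 16 ℤ.* ((+ 4 ℤ.* s) ℤ.* (+ 4 ℤ.* s)) ℤ.- + 64 ℤ.* (m ℤ.* m ℤ.* c ℤ.* u)
      ≡⟨ form₂ (m ℤ.* m ℤ.* c ℤ.* u) s ⟩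
    + 64 ℤ.* (ℤ.- (m ℤ.* m ℤ.* c ℤ.* u) ℤ.+ + 2 ℤ.* (+ 2 ℤ.* (s ℤ.* s))) ∎)
  (odd-+-evenℤ (ℤ.- (m ℤ.* m ℤ.* c ℤ.* u)) _ (odd-negℤ {m ℤ.* m ℤ.* c ℤ.* u}
    (odd-*ℤ {m ℤ.* m ℤ.* c} {u} (odd-*ℤ {m ℤ.* m} {c} (odd-*ℤ {m} {m} odd-m odd-m) odd-c) odd-u)))
  where
  open ≡-Reasoning
  form₁ : ∀ m c u → doubling-numeratorℤ (A₀ m) (B₀ m c) (+ 2 ℤ.* u)
          ≡ + 16 ℤ.* ((u ℤ.* u ℤ.+ + 3 ℤ.* (m ℤ.* m)) ℤ.* (u ℤ.* u ℤ.+ + 3 ℤ.* (m ℤ.* m))) ℤ.- + 64 ℤ.* (m ℤ.* m ℤ.* c ℤ.* u)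
  form₁ = ℤS.solve 3 (λ m c u → polyℤ (doubling-numeratorᴱ (A₀ᴱ (‵ m)) (B₀ᴱ (‵ m) (‵ c)) (# + 2 ⊗ ‵ u))
    := con (+ 16) :* ((u :* u :+ con (+ 3) :* (m :* m)) :* (u :* u :+ con (+ 3) :* (m :* m)))
       :- con (+ 64) :* (m :* m :* c :* u)) refl
    where open ℤS
  form₂ : ∀ w s → + 16 ℤ.* ((+ 4 ℤ.* s) ℤ.* (+ 4 ℤ.* s)) ℤ.- + 64 ℤ.* w ≡ + 64 ℤ.* (ℤ.- w ℤ.+ + 2 ℤ.* (+ 2 ℤ.* (s ℤ.* s)))
  form₂ = ℤSolver.solve-∀

2^4∥numerator[4t] : ∀ m c t → Odd ℤ.∣ m ∣ →
                       2^ 4 ∥ ℤ.∣ doubling-numeratorℤ (A₀ m) (B₀ m c) (+ 2 ℤ.* (+ 2 ℤ.* t)) ∣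
2^4∥numerator[4t] m c t odd-m = ≡2^e*odd⇒∥ 4 (r ℤ.* r ℤ.+ + 2 ℤ.* (ℤ.- (+ 4 ℤ.* (m ℤ.* m) ℤ.* c ℤ.* t)))
  (form m c t) (odd-+-evenℤ (r ℤ.* r) _ (odd-*ℤ {r} {r} odd-r odd-r))
  where
  open ℤS
  r = m ℤ.* m ℤ.+ + 2 ℤ.* (m ℤ.* m ℤ.+ + 2 ℤ.* (t ℤ.* t))
  odd-r : Odd ℤ.∣ r ∣
  odd-r = odd-+-evenℤ (m ℤ.* m) _ (odd-*ℤ {m} {m} odd-m odd-m)
  form : ∀ m c t → doubling-numeratorℤ (A₀ m) (B₀ m c) (+ 2 ℤ.* (+ 2 ℤ.* t))
         ≡ + 16 ℤ.* ((m ℤ.* m ℤ.+ + 2 ℤ.* (m ℤ.* m ℤ.+ + 2 ℤ.* (t ℤ.* t))) ℤ.* (m ℤ.* m ℤ.+ + 2 ℤ.* (m ℤ.* m ℤ.+ + 2 ℤ.* (t ℤ.* t)))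
                     ℤ.+ + 2 ℤ.* (ℤ.- (+ 4 ℤ.* (m ℤ.* m) ℤ.* c ℤ.* t)))
  form = solve 3 (λ m c t → polyℤ (doubling-numeratorᴱ (A₀ᴱ (‵ m)) (B₀ᴱ (‵ m) (‵ c)) (# + 2 ⊗ (# + 2 ⊗ ‵ t)))
    := con (+ 16) :* ((m :* m :+ con (+ 2) :* (m :* m :+ con (+ 2) :* (t :* t)))
                      :* (m :* m :+ con (+ 2) :* (m :* m :+ con (+ 2) :* (t :* t)))
                      :+ con (+ 2) :* (:- (con (+ 4) :* (m :* m) :* c :* t)))) refl

data TwoAdicClass (x : ℤ) : Set where
  odd        : ¬ (+ 2 ℤD.∣ x) → TwoAdicClass x
  twice-odd  : + 2 ℤD.∣ x → ¬ (+ 4 ℤD.∣ x) → TwoAdicClass x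
  four-times : + 4 ℤD.∣ x → TwoAdicClass x

classify : ∀ x → TwoAdicClass x
classify x with 2 ∣? ℤ.∣ x ∣ | 4 ∣? ℤ.∣ x ∣
... | no ¬2∣x | _       = odd ¬2∣x
... | yes 2∣x | no ¬4∣x = twice-odd 2∣x ¬4∣x
... | _       | yes 4∣x = four-times 4∣x

4∣⇒2∣ : ∀ {x} → + 4 ℤD.∣ x → + 2 ℤD.∣ x
4∣⇒2∣ = ND.∣-trans (divides 2 refl)

twice-odd-form : ∀ x → + 2 ℤD.∣ x → ¬ (+ 4 ℤD.∣ x) → Σ ℤ λ u → Odd ℤ.∣ u ∣ × x ≡ + 2 ℤ.* u
twice-odd-form x 2∣x ¬4∣x with ∣ᵤ⇒∣ {+ 2} {x} 2∣x
... | ℤDˢ.divides u x≡u2 = u , odd-u , trans x≡u2 (ℤP.*-comm u (+ 2))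
  where
  odd-u : Odd ℤ.∣ u ∣
  odd-u 2∣u with ∣ᵤ⇒∣ {+ 2} {u} 2∣u
  ... | ℤDˢ.divides v u≡v2 = ¬4∣x (∣⇒∣ᵤ (ℤDˢ.divides v (trans x≡u2 (trans (cong (ℤ._* + 2) u≡v2) (ℤP.*-assoc v (+ 2) (+ 2))))))

four-times-form : ∀ x → + 4 ℤD.∣ x → Σ ℤ λ t → x ≡ + 2 ℤ.* (+ 2 ℤ.* t)
four-times-form x 4∣x with ∣ᵤ⇒∣ {+ 4} {x} 4∣x
... | ℤDˢ.divides t x≡t4 = t , trans x≡t4 (trans (ℤP.*-comm t (+ 4)) (ℤP.*-assoc (+ 2) (+ 2) t))

double-odd : ∀ m c x y → ¬ (+ 2 ℤD.∣ x) → OnCurve (A₀ m) (B₀ m c) (aff (fromℤ x) y) →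
             DoubleShape (A₀ m) (aff (fromℤ x) y) 0 2
double-odd m c x y odd-x on = double-integral (A₀ m) (B₀ m c) x y on
  (≡2^e*odd⇒∥ 2 (cubicℤ (A₀ m) (B₀ m c) x) refl (cubic-odd m c x odd-x)) (odd⇒2^0∥ (numerator-odd (A₀ m) (B₀ m c) x (slope-odd m x odd-x)))

ValuationTable : ℤ → ℤ → ℚ → Set
ValuationTable A x y = Σ ℚ λ X → Σ ℚ λ Y → (mul2 A (aff (fromℤ x) y) ≡ aff X Y) × (X ≢ 0ℚ)
  × ((+ 4 ℤD.∣ x) → vℚ 2 X ≡ + 0)
  × ((+ 2 ℤD.∣ x) → ¬ (+ 4 ℤD.∣ x) → vℚ 2 X ≡ + 2)
  × (¬ (+ 2 ℤD.∣ x) → vℚ 2 X ≡ -[1+ 1 ])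

shape⇒table : ∀ {A x y a b} → DoubleShape A (aff (fromℤ x) y) a b →
              ((+ 4 ℤD.∣ x) → + a ℤ.- + b ≡ + 0) →
              ((+ 2 ℤD.∣ x) → ¬ (+ 4 ℤD.∣ x) → + a ℤ.- + b ≡ + 2) →
              (¬ (+ 2 ℤD.∣ x) → + a ℤ.- + b ≡ -[1+ 1 ]) →
              ValuationTable A x y
shape⇒table (X , Y , 2P≡XY , shape) v₀ v₂ v₋₂ =
  X , Y , 2P≡XY , shape⇒≢0 {X = X} shape ,
  (λ 4∣x → trans v (v₀ 4∣x)) , (λ 2∣x ¬4∣x → trans v (v₂ 2∣x ¬4∣x)) , (λ ¬2∣x → trans v (v₋₂ ¬2∣x))
  where v = shape⇒vℚ {X = X} shape

module _ {m c : ℤ} (odd-m : Odd ℤ.∣ m ∣) (odd-c : Odd ℤ.∣ c ∣) where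

  private
    A B : ℤ
    A = A₀ m
    B = B₀ m c

  double-twice-odd : ∀ x y → + 2 ℤD.∣ x → ¬ (+ 4 ℤD.∣ x) → OnCurve A B (aff (fromℤ x) y) →
                     DoubleShape A (aff (fromℤ x) y) 2 0
  double-twice-odd x y 2∣x ¬4∣x on with twice-odd-form x 2∣x ¬4∣x
  ... | u , odd-u , refl = double-integral A B (+ 2 ℤ.* u) y on
    (2^4∥4cubic[2u] m c u odd-m odd-c) (2^6∥numerator[2u] m c u odd-m odd-c odd-u)

  double-four-times : ∀ x y → + 4 ℤD.∣ x → OnCurve A B (aff (fromℤ x) y) →
                      DoubleShape A (aff (fromℤ x) y) 0 0
  double-four-times x y 4∣x on with four-times-form x 4∣x
  ... | t , refl = double-integral A B (+ 2 ℤ.* (+ 2 ℤ.* t)) y on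
    (2^4∥4cubic[2u] m c (+ 2 ℤ.* t) odd-m odd-c) (2^4∥numerator[4t] m c t odd-m)

  four-times-4P-fractional : ∀ x y → + 4 ℤD.∣ x → OnCurve A B (aff (fromℤ x) y) →
                             FractionalX (mul4 A (aff (fromℤ x) y))
  four-times-4P-fractional x y 4∣x on with double-four-times x y 4∣x on
  ... | 2P@(X , Y , 2P≡XY , odd-↥X , _) rewrite 2P≡XY with ↧ₙ X ℕ.≟ 1
  ... | no  ↧X≢1 = double-fractionalX A B (aff X Y) (shape⇒double-onCurve A B on 2P) ↧X≢1
  ... | yes ↧X≡1 = subst (λ X → FractionalX (double A (aff X Y))) (sym X≡z)
    (shape⇒double-fractional (double-odd m c (↥ X) Y (2^0∥⇒odd odd-↥X)
      (subst (λ X → OnCurve A B (aff X Y)) X≡z (shape⇒double-onCurve A B on 2P))))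
    where X≡z = ↧ₙ≡1⇒≡fromℤ X ↧X≡1

  twice-odd-8P-fractional : ∀ x y → + 2 ℤD.∣ x → ¬ (+ 4 ℤD.∣ x) → OnCurve A B (aff (fromℤ x) y) →
                            FractionalX (mul8 A (aff (fromℤ x) y))
  twice-odd-8P-fractional x y 2∣x ¬4∣x on with double-twice-odd x y 2∣x ¬4∣x on
  ... | 2P@(X , Y , 2P≡XY , exact q _ ∣↥X∣≡4q , _) rewrite 2P≡XY with ↧ₙ X ℕ.≟ 1
  ... | no  ↧X≢1 = mul2-fractional⇒mul4 A B (aff X Y) on₂ (double-fractionalX A B (aff X Y) on₂ ↧X≢1)
    where on₂ = shape⇒double-onCurve A B on 2P
  ... | yes ↧X≡1 = subst (λ X → FractionalX (mul4 A (aff X Y))) (sym X≡z)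
    (four-times-4P-fractional (↥ X) Y (divides q (trans ∣↥X∣≡4q (ℕP.*-comm 4 q)))
      (subst (λ X → OnCurve A B (aff X Y)) X≡z (shape⇒double-onCurve A B on 2P)))
    where X≡z = ↧ₙ≡1⇒≡fromℤ X ↧X≡1

  mul8-fractional : ∀ x y → OnCurve A B (aff (fromℤ x) y) → FractionalX (mul8 A (aff (fromℤ x) y))
  mul8-fractional x y on with classify x
  ... | odd ¬2∣x           = mul4-fractional⇒mul8 A B (aff (fromℤ x) y) on
                               (mul2-fractional⇒mul4 A B (aff (fromℤ x) y) on
                                 (shape⇒double-fractional (double-odd m c x y ¬2∣x on)))
  ... | twice-odd 2∣x ¬4∣x = twice-odd-8P-fractional x y 2∣x ¬4∣x on
  ... | four-times 4∣x     = mul4-fractional⇒mul8 A B (aff (fromℤ x) y) on (four-times-4P-fractional x y 4∣x on)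

  valuation-table : ∀ x y → OnCurve A B (aff (fromℤ x) y) → ValuationTable A x y
  valuation-table x y on with classify x
  ... | odd ¬2∣x = shape⇒table {x = x} (double-odd m c x y ¬2∣x on)
    (λ 4∣x → contradiction (4∣⇒2∣ {x} 4∣x) ¬2∣x) (λ 2∣x _ → contradiction 2∣x ¬2∣x) (λ _ → refl)
  ... | twice-odd 2∣x ¬4∣x = shape⇒table {x = x} (double-twice-odd x y 2∣x ¬4∣x on)
    (λ 4∣x → contradiction 4∣x ¬4∣x) (λ _ _ → refl) (λ ¬2∣x → contradiction 2∣x ¬2∣x)
  ... | four-times 4∣x = shape⇒table {x = x} (double-four-times x y 4∣x on)
    (λ _ → refl) (λ _ ¬4∣x → contradiction 4∣x ¬4∣x) (λ ¬2∣x → contradiction (4∣⇒2∣ {x} 4∣x) ¬2∣x)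

lemma1 : (k l : ℕ) → 0 < k → 0 < l → k ≢ l → Coprime k l → SquareFree k → SquareFree l → (2 ∣ k ⊎ 2 ∣ l) →
         (x y : ℤ) → y ℤ.* y ≡ x ℤ.* x ℤ.* x ℤ.+ coefA k l ℤ.* x ℤ.+ coefB k l →
         Σ ℚ (λ X → Σ ℚ (λ Y →
           (mul2 (coefA k l) (aff (fromℤ x) (fromℤ y)) ≡ aff X Y) × (X ≢ 0ℚ)
           × ((+ 4 ℤD.∣ x) → vℚ 2 X ≡ + 0)
           × ((+ 2 ℤD.∣ x) → ¬ (+ 4 ℤD.∣ x) → vℚ 2 X ≡ + 2)
           × (¬ (+ 2 ℤD.∣ x) → vℚ 2 X ≡ -[1+ 1 ])))
         × ¬ IsIntegral (mul8 (coefA k l) (aff (fromℤ x) (fromℤ y)))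
lemma1 k l _ _ _ coprime squarefree-k squarefree-l 2∣k⊎2∣l x y y²≡fx
  with coefA k l | coefB k l | normal-form k l coprime squarefree-k squarefree-l 2∣k⊎2∣l
... | _ | _ | m , c , odd-m , odd-c , refl , refl =
  valuation-table {m} {c} odd-m odd-c x (fromℤ y) on ,
  fractionalX⇒¬integral _ (mul8-fractional {m} {c} odd-m odd-c x (fromℤ y) on)
  where on = integral-onCurve (A₀ m) (B₀ m c) x y y²≡fx
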